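{- None of the classes $\mathcal{C}(\Delta)_1$, $\mathcal{C}(\Delta)_3$ (in the homomorphism order $\mathcal{C}(\Delta)$) and $\mathbb{D}_5$ (in the homomorphism order $\mathbb{D}$ of digraphs) is cut-free.
   Context: A type $\Delta=(\delta_i:i\in I)$ is a finite family of integers $\delta_i\ge 2$. A $\Delta$-structure $A$ consists of a finite nonempty base set $\underline{A}$ and relations $R_i(A)\subseteq \underline{A}^{\delta_i}$. A homomorphism $A\to A'$ is a map of base sets sending each tuple of $R_i(A)$ to a tuple of $R_i(A')$; write $A\le A'$ if one exists. A core is a structure with no homomorphism to a proper substructure. $\mathcal{C}(\Delta)$ is the set of core $\Delta$-structures up to isomorphism ordered by $\le$; $\mathbb{D}$ is this order for digraphs ($\Delta=(2)$). The incidence graph of $A$ is the bipartite multigraph with parts $\underline{A}$ and $\{(i,e):i\in I,e\in R_i(A)\}$, with one edge between $a$ and $(i,(a_1,\dots,a_{\delta_i}))$ for each $j$ with $a_j=a$; $A$ is a $\Delta$-tree if its incidence graph is a tree, and contains a cycle if its incidence graph contains a cycle. $\mathcal{C}(\Delta)_1$ is the set of cores not homomorphic to any $\Delta$-tree; $\mathcal{C}(\Delta)_3$ is the set of cores containing a cycle; $\mathbb{D}_5$ is the set of core digraphs containing an odd cycle (in the underlying undirected graph). For a subset $\mathcal{A}$ of a poset $\mathcal{P}$, $\mathcal{A}$ is cut-free if there are no $Y\in\mathcal{A}$ and $X,Z\in\mathcal{P}$ with $X<Y<Z$ and $\mathcal{A}\cap[X,Z]=\mathcal{A}\cap([X,Y]\cup[Y,Z])$,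 where $[U,V]=\{W:U\le W\le V\}$. -}

module Defs where

open import Data.Nat using (ℕ; zero; suc; _≤_; _*_)
open import Data.Fin using (Fin; zero; suc; inject₁; fromℕ)
open import Data.Vec using (Vec; lookup; map)
open import Data.Bool using (Bool; T)
open import Data.Product using (Σ; _×_; _,_; ∃)
open import Data.Sum using (_⊎_)
open import Relation.Nullary using (¬_)
open import Relation.Binary.PropositionalEquality using (_≡_; _≢_)
open import Relation.Binary.Construct.Closure.ReflexiveTransitive using (Star)
open import Function.Definitions using (Injective)

record RelType : Set where
  field
    k    : ℕ
    δ    : Fin k → ℕ
    δ≥2  : ∀ i → 2 ≤ δ i
open RelType public

record Str (Δ : RelType) : Set where
  field
    m : ℕ
    R : (i : Fin (k Δ)) → Vec (Fin (suc m)) (δ Δ i) → Bool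

  Base : Set
  Base = Fin (suc m)
open Str public

module _ {Δ : RelType} where

  IsHom : (A B : Str Δ) → (Base A → Base B) → Set
  IsHom A B f = ∀ i (t : Vec (Base A) (δ Δ i)) → T (R A i t) → T (R B i (map f t))

  _⟶_ : Str Δ → Str Δ → Set
  A ⟶ B = Σ (Base A → Base B) (IsHom A B)

  -- strict order in the poset of (isomorphism classes of) cores
  _⟶⟶_ : Str Δ → Str Δ → Set
  A ⟶⟶ B = (A ⟶ B) × ¬ (B ⟶ A)

  record Sub (A : Str Δ) : Set where
    field
      S      : Base A → Bool
      R'     : (i : Fin (k Δ)) → Vec (Base A) (δ Δ i) → Bool
      R'⊆R   : ∀ i t → T (R' i t) → T (R A i t)
      R'⊆S   : ∀ i t → T (R' i t) → ∀ j → T (S (lookup t j))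
  open Sub public

  Proper : {A : Str Δ} → Sub A → Set
  Proper {A} B = (∃ λ x → ¬ T (S B x))
               ⊎ (Σ (Fin (k Δ)) λ i → ∃ λ t → T (R A i t) × ¬ T (R' B i t))

  HomToSub : (A : Str Δ) → Sub A → Set
  HomToSub A B = Σ (Base A → Base A) λ f →
      (∀ x → T (S B (f x)))
    × (∀ i (t : Vec (Base A) (δ Δ i)) → T (R A i t) → T (R' B i (map f t)))

  IsCore : Str Δ → Set
  IsCore A = ¬ (Σ (Sub A) λ B → Proper B × HomToSub A B)

  -- Incidence graph: vertices are elements of A and pairs (i,e) with
  -- e ∈ R_i(A); for each j with e_j = a an edge between a and (i,e).

  Hyper : Str Δ → Set
  Hyper A = Σ (Fin (k Δ)) λ i → Σ (Vec (Base A) (δ Δ i)) λ e → T (R A i e)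

  IVertex : Str Δ → Set
  IVertex A = Base A ⊎ Hyper A

  data IAdj (A : Str Δ) : IVertex A → IVertex A → Set where
    el-hy : ∀ {a} (h : Hyper A) (j : Fin (δ Δ (Data.Product.proj₁ h))) →
            lookup (Data.Product.proj₁ (Data.Product.proj₂ h)) j ≡ a →
            IAdj A (Data.Sum.inj₁ a) (Data.Sum.inj₂ h)
    hy-el : ∀ {a} (h : Hyper A) (j : Fin (δ Δ (Data.Product.proj₁ h))) →
            lookup (Data.Product.proj₁ (Data.Product.proj₂ h)) j ≡ a →
            IAdj A (Data.Sum.inj₂ h) (Data.Sum.inj₁ a)

  IConnected : Str Δ → Set
  IConnected A = ∀ (v w : IVertex A) → Star (IAdj A) v w

  -- A cycle in the incidence graph (a bipartite multigraph):
  -- a_0,(i_0,e_0),a_1,(i_1,e_1),…,a_L,(i_L,e_L),a_0 with all a_t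
  -- distinct, all (i_t,e_t) distinct, a_t = e_t[j_t], a_{t+1} = e_t[j'_t],
  -- and j_t ≠ j'_t (the two edges at (i_t,e_t) are distinct; for L = 0
  -- this is a pair of parallel edges).
  record ICycle (A : Str Δ) : Set where
    field
      L     : ℕ
      a     : Fin (suc L) → Base A
      h     : Fin (suc L) → Hyper A
      j j'  : (t : Fin (suc L)) → Fin (δ Δ (Data.Product.proj₁ (h t)))
      j≢j'  : ∀ t → j t ≢ j' t
      in-at : ∀ t → lookup (Data.Product.proj₁ (Data.Product.proj₂ (h t))) (j t) ≡ a t
      out-step : ∀ (t : Fin L) →
        lookup (Data.Product.proj₁ (Data.Product.proj₂ (h (inject₁ t)))) (j' (inject₁ t)) ≡ a (suc t)
      out-last :
        lookup (Data.Product.proj₁ (Data.Product.proj₂ (h (fromℕ L)))) (j' (fromℕ L)) ≡ a zero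
      a-inj : Injective _≡_ _≡_ a
      h-inj : Injective _≡_ _≡_ h

  IsTree : Str Δ → Set
  IsTree A = IConnected A × ¬ ICycle A

  HasCycle : Str Δ → Set
  HasCycle A = ICycle A

  -- Cut-freeness of a class 𝒜 ⊆ 𝒫 = C(Δ) (classes are predicates on
  -- structures, closed under isomorphism; the elements of C(Δ) are
  -- the core structures).

  Interval : Str Δ → Str Δ → Str Δ → Set
  Interval U V W = (U ⟶ W) × (W ⟶ V)

  IsCut : (Str Δ → Set) → (X Y Z : Str Δ) → Set
  IsCut 𝒜 X Y Z =
      𝒜 Y × IsCore X × IsCore Z × (X ⟶⟶ Y) × (Y ⟶⟶ Z)
    × (∀ W → IsCore W →
         ((𝒜 W × Interval X Z W) → (𝒜 W × (Interval X Y W ⊎ Interval Y Z W)))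
       × ((𝒜 W × (Interval X Y W ⊎ Interval Y Z W)) → (𝒜 W × Interval X Z W)))

  CutFree : (Str Δ → Set) → Set
  CutFree 𝒜 = ¬ (Σ (Str Δ) λ X → Σ (Str Δ) λ Y → Σ (Str Δ) λ Z → IsCut 𝒜 X Y Z)

  C₁ : Str Δ → Set
  C₁ A = IsCore A × ¬ (Σ (Str Δ) λ T' → IsTree T' × (A ⟶ T'))

  C₃ : Str Δ → Set
  C₃ A = IsCore A × HasCycle A

DigraphType : RelType
DigraphType = record { k = 1 ; δ = λ _ → 2 ; δ≥2 = λ _ → Data.Nat.s≤s (Data.Nat.s≤s Data.Nat.z≤n) }

Digraph : Set
Digraph = Str DigraphType

arc : (G : Digraph) → Base G → Base G → Bool
arc G u v = R G zero (u Data.Vec.∷ v Data.Vec.∷ Data.Vec.[])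

UAdj : (G : Digraph) → Base G → Base G → Set
UAdj G u v = T (arc G u v) ⊎ T (arc G v u)

-- an odd cycle v_0,…,v_{2r} (length 2r+1; r = 0 is a loop) with
-- pairwise distinct vertices in the underlying undirected graph
record OddCycle (G : Digraph) : Set where
  field
    r     : ℕ
    v     : Fin (suc (2 * r)) → Base G
    v-inj : Injective _≡_ _≡_ v
    step  : ∀ (t : Fin (2 * r)) → UAdj G (v (inject₁ t)) (v (suc t))
    last  : UAdj G (v (fromℕ (2 * r))) (v zero)

D₅ : Digraph → Set
D₅ G = IsCore G × OddCycle G

-- Fix a relation i₀ of Δ and read its tuples as arcs (first entry to second). Take X = TT₃, the
-- transitive tournament on three vertices, Z = a single vertex carrying every tuple of i₀, and
-- Y = TT₃ ⊎ P₃, the disjoint union of TT₃ with a directed path of three arcs. All three are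
-- rigid, hence cores, and X < Y < Z. A structure W with X ≤ W ≤ Z either contains a walk of
-- three arcs, and then Y ≤ W, or it does not, and then the length of a longest walk ending at a
-- vertex is a homomorphism W → TT₃, so W ≤ X ≤ Y. Thus [X, Z] = [X, Y] ∪ [Y, Z], and no class
-- containing Y is cut-free. Every homomorphic image of the triangle TT₃ contains a cycle (a
-- triangle or a loop), so Y lies in C(Δ)₁ and C(Δ)₃; for digraphs the triangle is an odd cycle.

module Submission where

open import Defs
open import Data.Nat using (ℕ; zero; suc; _≤_; z≤n; s≤s; _+_; _*_; _∸_)
open import Data.Nat.Properties using (m+[n∸m]≡n; ≤-reflexive)
open import Data.Fin using (Fin; zero; suc; toℕ; inject₁; fromℕ<; cast; _<_; _≟_)
open import Data.Fin.Properties
  using (any?; cast-involutive; suc-injective; inject₁-injective; toℕ-inject₁; <-irrefl; _<?_; +↔⊎; *↔×)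
open import Data.Vec using (Vec; []; _∷_; lookup; map; tabulate; replicate)
open import Data.Vec.Properties
  using (lookup-map; map-cong; map-id; map-∘; lookup∘tabulate; tabulate∘lookup; tabulate-cong; ≡-dec)
open import Data.Bool using (T)
open import Data.Unit using (⊤; tt)
open import Data.Empty using (⊥; ⊥-elim)
open import Data.Product using (_×_; _,_; ∃; proj₁; proj₂)
open import Data.Sum using (_⊎_; inj₁; inj₂)
open import Relation.Nullary using (¬_; Dec; yes; no)
open import Relation.Nullary.Decidable using (⌊_⌋; toWitness; fromWitness; _×-dec_; T?)
open import Relation.Binary.PropositionalEquality using (_≡_; _≢_; refl; sym; trans; cong; subst; subst₂; module ≡-Reasoning)
open import Function.Definitions using (Injective)
open import Function.Bundles using (_↔_; Inverse)
open import Function.Construct.Identity using (↔-id)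
open import Function.Construct.Composition using (_↔-∘_)
open import Data.Sum.Function.Propositional using (_⊎-↔_)
open import Data.Sum.Properties using (inj₁-injective; inj₂-injective)

∃-Vec? : ∀ {a} n {P : Vec (Fin a) n → Set} → (∀ t → Dec (P t)) → Dec (∃ P)
∃-Vec? zero P? with P? []
... | yes p = yes ([] , p)
... | no ¬p = no λ { ([] , p) → ¬p p }
∃-Vec? (suc n) P? with any? (λ x → ∃-Vec? n (λ t → P? (x ∷ t)))
... | yes (x , t , p) = yes (x ∷ t , p)
... | no ¬p = no λ { (x ∷ t , p) → ¬p (x , t , p) }

injective₃ : {A : Set} (f : Fin 3 → A) →
             f zero ≢ f (suc zero) → f (suc zero) ≢ f (suc (suc zero)) → f zero ≢ f (suc (suc zero)) →
             Injective _≡_ _≡_ f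
injective₃ f _   _   _   {zero}           {zero}           _ = refl
injective₃ f _   _   _   {suc zero}       {suc zero}       _ = refl
injective₃ f _   _   _   {suc (suc zero)} {suc (suc zero)} _ = refl
injective₃ f f01 _   _   {zero}           {suc zero}       e = ⊥-elim (f01 e)
injective₃ f _   _   f02 {zero}           {suc (suc zero)} e = ⊥-elim (f02 e)
injective₃ f f01 _   _   {suc zero}       {zero}           e = ⊥-elim (f01 (sym e))
injective₃ f _   f12 _   {suc zero}       {suc (suc zero)} e = ⊥-elim (f12 e)
injective₃ f _   _   f02 {suc (suc zero)} {zero}           e = ⊥-elim (f02 (sym e))
injective₃ f _   f12 _   {suc (suc zero)} {suc zero}       e = ⊥-elim (f12 (sym e))

0<1 : zero {2} < suc {2} zero
0<1 = s≤s z≤n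

1<2 : suc {2} zero < suc {2} (suc zero)
1<2 = s≤s (s≤s z≤n)

0<2 : zero {2} < suc {2} (suc zero)
0<2 = s≤s z≤n

<-chain₃ : {a b c : Fin 3} → a < b → b < c → a ≡ zero × b ≡ suc zero × c ≡ suc (suc zero)
<-chain₃ {zero}  {suc zero}       {suc (suc zero)} _ _ = refl , refl , refl
<-chain₃ {suc _} {suc zero}       (s≤s ()) _
<-chain₃ {_}     {suc zero}       {suc zero}       _ (s≤s ())
<-chain₃ {_}     {suc (suc zero)} {suc zero}       _ (s≤s ())
<-chain₃ {_}     {suc (suc zero)} {suc (suc zero)} _ (s≤s (s≤s ()))
<-chain₃ {_}     {_}              {zero}           _ ()
<-chain₃ {_}     {zero}           () _

∀-Fin3 : {P : Fin 3 → Set} → P zero × P (suc zero) × P (suc (suc zero)) → ∀ x → P x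
∀-Fin3 (p₀ , _  , _ ) zero             = p₀
∀-Fin3 (_  , p₁ , _ ) (suc zero)       = p₁
∀-Fin3 (_  , _  , p₂) (suc (suc zero)) = p₂

rank : {A B : Set} → Dec A → Dec B → Fin 3
rank (yes _) _       = suc (suc zero)
rank (no _)  (yes _) = suc zero
rank (no _)  (no _)  = zero

rank-< : {A₁ B₁ A₂ B₂ : Set} (a₁ : Dec A₁) (b₁ : Dec B₁) (a₂ : Dec A₂) (b₂ : Dec B₂) →
         ¬ A₁ → (B₁ → A₂) → B₂ → rank a₁ b₁ < rank a₂ b₂
rank-< (yes x) _       _        _        ¬x _ _ = ⊥-elim (¬x x)
rank-< (no _)  (yes _) (yes _)  _        _  _ _ = s≤s (s≤s z≤n)
rank-< (no _)  (yes y) (no ¬x₂) _        _  f _ = ⊥-elim (¬x₂ (f y))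
rank-< (no _)  (no _)  (yes _)  _        _  _ _ = s≤s z≤n
rank-< (no _)  (no _)  (no _)   (yes _)  _  _ _ = s≤s z≤n
rank-< (no _)  (no _)  (no _)   (no ¬y₂) _  _ y = ⊥-elim (¬y₂ y)

¬<-chain₄ : {a b c e : Fin 3} → a < b → b < c → c < e → ⊥
¬<-chain₄ a<b b<c c<e with <-chain₃ b<c c<e
¬<-chain₄ () _ _ | refl , _

suc≡inject₁⇒< : ∀ {n} {a b : Fin n} → suc a ≡ inject₁ b → a < b
suc≡inject₁⇒< {b = b} e = ≤-reflexive (trans (cong toℕ e) (toℕ-inject₁ b))

module _ {Δ : RelType} where

  _∘ʰ_ : {A B C : Str Δ} → B ⟶ C → A ⟶ B → A ⟶ C
  _∘ʰ_ {C = C} (g , g-hom) (f , f-hom) = (λ x → g (f x)) , λ i t r →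
    subst (λ u → T (R C i u)) (sym (map-∘ g f t)) (g-hom i (map f t) (f-hom i t r))

  Rigid : Str Δ → Set
  Rigid A = ∀ f → IsHom A A f → ∀ x → f x ≡ x

  rigid⇒core : (A : Str Δ) → Rigid A → IsCore A
  rigid⇒core A rigid (B , proper , f , f∈S , f-hom) = not-proper proper
    where
    fixed : ∀ x → f x ≡ x
    fixed = rigid f (λ i t r → R'⊆R B i (map f t) (f-hom i t r))
    not-proper : ¬ Proper B
    not-proper (inj₁ (x , x∉S)) = x∉S (subst (λ y → T (S B y)) (fixed x) (f∈S x))
    not-proper (inj₂ (i , t , t∈R , t∉R')) =
      t∉R' (subst (λ u → T (R' B i u)) (trans (map-cong fixed t) (map-id t)) (f-hom i t t∈R))

  Interval-trans : {X Y Z W : Str Δ} → X ⟶ Y → Y ⟶ Z →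
                   Interval X Y W ⊎ Interval Y Z W → Interval X Z W
  Interval-trans {X} {Y} {Z} {W} _ Y⟶Z (inj₁ (X⟶W , W⟶Y)) = X⟶W , _∘ʰ_ {W} {Y} {Z} Y⟶Z W⟶Y
  Interval-trans {X} {Y} {Z} {W} X⟶Y _ (inj₂ (Y⟶W , W⟶Z)) = _∘ʰ_ {X} {Y} {W} Y⟶W X⟶Y , W⟶Z

-- Positions in a tuple of relation i are indexed by Fin (2 + extra); a tuple is read as an
-- arc from its entry at the first position to its entry at the second.
module Positions (Δ : RelType) (i : Fin (k Δ)) where

  extra : ℕ
  extra = δ Δ i ∸ 2

  position : Fin (2 + extra) → Fin (δ Δ i)
  position = cast (m+[n∸m]≡n (δ≥2 Δ i))

  position⁻¹ : Fin (δ Δ i) → Fin (2 + extra)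
  position⁻¹ = cast (sym (m+[n∸m]≡n (δ≥2 Δ i)))

  position⁻¹-position : (p : Fin (2 + extra)) → position⁻¹ (position p) ≡ p
  position⁻¹-position = cast-involutive (sym (m+[n∸m]≡n (δ≥2 Δ i))) (m+[n∸m]≡n (δ≥2 Δ i))

  position-position⁻¹ : (j : Fin (δ Δ i)) → position (position⁻¹ j) ≡ j
  position-position⁻¹ = cast-involutive (m+[n∸m]≡n (δ≥2 Δ i)) (sym (m+[n∸m]≡n (δ≥2 Δ i)))

  src tgt : {A : Set} → Vec A (δ Δ i) → A
  src t = lookup t (position zero)
  tgt t = lookup t (position (suc zero))

  src-map : {A B : Set} (f : A → B) (t : Vec A (δ Δ i)) → src (map f t) ≡ f (src t)
  src-map f t = lookup-map (position zero) f t

  tgt-map : {A B : Set} (f : A → B) (t : Vec A (δ Δ i)) → tgt (map f t) ≡ f (tgt t)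
  tgt-map f t = lookup-map (position (suc zero)) f t

  src≢tgt-position : position zero ≢ position (suc zero)
  src≢tgt-position e with trans (sym (position⁻¹-position zero))
                               (trans (cong position⁻¹ e) (position⁻¹-position (suc zero)))
  ... | ()

  tuple : {A : Set} → (Fin (2 + extra) → A) → Vec A (δ Δ i)
  tuple F = tabulate (λ j → F (position⁻¹ j))

  lookup-tuple : {A : Set} (F : Fin (2 + extra) → A) (p : Fin (2 + extra)) →
                 lookup (tuple F) (position p) ≡ F p
  lookup-tuple F p = trans (lookup∘tabulate _ (position p)) (cong F (position⁻¹-position p))

  tuple-ext : {A : Set} {u v : Vec A (δ Δ i)} →
              (∀ p → lookup u (position p) ≡ lookup v (position p)) → u ≡ v
  tuple-ext {u = u} {v} e = begin
    u                                  ≡⟨ tabulate∘lookup u ⟨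
    tabulate (lookup u)                ≡⟨ tabulate-cong pointwise ⟩
    tabulate (lookup v)                ≡⟨ tabulate∘lookup v ⟩
    v                                  ∎
    where
    open ≡-Reasoning
    pointwise : ∀ j → lookup u j ≡ lookup v j
    pointwise j = subst (λ j' → lookup u j' ≡ lookup v j') (position-position⁻¹ j) (e (position⁻¹ j))

module _ {Δ : RelType} (B : Str Δ) (i : Fin (k Δ)) where

  open Positions Δ i

  private
    Tuple : Set
    Tuple = Vec (Base B) (δ Δ i)

    hyperSrc hyperTgt : Hyper B → Base B
    hyperSrc (i' , e , _) = Positions.src Δ i' e
    hyperTgt (i' , e , _) = Positions.tgt Δ i' e

  loop⇒cycle : (t : Tuple) → T (R B i t) → src t ≡ tgt t → ICycle B
  loop⇒cycle t t∈R src≡tgt = record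
    { L = 0 ; a = λ _ → src t ; h = λ _ → i , t , t∈R
    ; j = λ _ → position zero ; j' = λ _ → position (suc zero)
    ; j≢j' = λ _ → src≢tgt-position ; in-at = λ _ → refl ; out-step = λ ()
    ; out-last = sym src≡tgt
    ; a-inj = λ { {zero} {zero} _ → refl } ; h-inj = λ { {zero} {zero} _ → refl } }

  -- The cycle u, a, v, b, w, c, u for arcs a : u → v, b : v → w, c : u → w; it traverses c backwards.
  triangle⇒cycle : (a b c : Tuple) → T (R B i a) → T (R B i b) → T (R B i c) →
                   tgt a ≡ src b → src a ≡ src c → tgt b ≡ tgt c →
                   src a ≢ tgt a → src b ≢ tgt b → src c ≢ tgt c → ICycle B
  triangle⇒cycle a b c a∈R b∈R c∈R ab ac bc a≢ b≢ c≢ = record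
    { L = 2 ; a = vertex ; h = hyperedge ; j = entry ; j' = exit ; j≢j' = entry≢exit
    ; in-at = enters ; out-step = leaves ; out-last = sym ac
    ; a-inj = injective₃ vertex a≢ (λ e → b≢ (trans (sym ab) e)) (λ e → c≢ (trans (sym ac) (trans e bc)))
    ; h-inj = injective₃ hyperedge (λ e → a≢ (trans (cong hyperSrc e) (sym ab)))
                             (λ e → a≢ (sym (trans ab (trans (cong hyperSrc e) (sym ac)))))
                             (λ e → b≢ (trans (sym ab) (trans (cong hyperTgt e) (sym bc)))) }
    where
    vertex : Fin 3 → Base B
    vertex zero             = src a
    vertex (suc zero)       = tgt a
    vertex (suc (suc zero)) = tgt b
    hyperedge : Fin 3 → Hyper B
    hyperedge zero             = i , a , a∈R
    hyperedge (suc zero)       = i , b , b∈R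
    hyperedge (suc (suc zero)) = i , c , c∈R
    entry exit : (s : Fin 3) → Fin (δ Δ (proj₁ (hyperedge s)))
    entry zero             = position zero
    entry (suc zero)       = position zero
    entry (suc (suc zero)) = position (suc zero)
    exit zero             = position (suc zero)
    exit (suc zero)       = position (suc zero)
    exit (suc (suc zero)) = position zero
    entry≢exit : ∀ s → entry s ≢ exit s
    entry≢exit zero             = src≢tgt-position
    entry≢exit (suc zero)       = src≢tgt-position
    entry≢exit (suc (suc zero)) = λ e → src≢tgt-position (sym e)
    enters : ∀ s → lookup (proj₁ (proj₂ (hyperedge s))) (entry s) ≡ vertex s
    enters zero             = refl
    enters (suc zero)       = sym ab
    enters (suc (suc zero)) = sym bc
    leaves : ∀ (s : Fin 2) → lookup (proj₁ (proj₂ (hyperedge (inject₁ s)))) (exit (inject₁ s)) ≡ vertex (suc s)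
    leaves zero       = refl
    leaves (suc zero) = refl

  transitive-triangle⇒cycle : (a b c : Tuple) → T (R B i a) → T (R B i b) → T (R B i c) →
                              tgt a ≡ src b → src a ≡ src c → tgt b ≡ tgt c → ICycle B
  transitive-triangle⇒cycle a b c a∈R b∈R c∈R ab ac bc
    with src a ≟ tgt a | src b ≟ tgt b | src c ≟ tgt c
  ... | yes a-loop | _          | _          = loop⇒cycle a a∈R a-loop
  ... | no _       | yes b-loop | _          = loop⇒cycle b b∈R b-loop
  ... | no _       | no _       | yes c-loop = loop⇒cycle c c∈R c-loop
  ... | no a≢      | no b≢      | no c≢      = triangle⇒cycle a b c a∈R b∈R c∈R ab ac bc a≢ b≢ c≢

module _ {Δ : RelType} (A : Str Δ) (i : Fin (k Δ)) where

  open Positions Δ i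

  WalkTo : ℕ → Base A → Set
  WalkTo zero    v = ⊤
  WalkTo (suc ℓ) v = ∃ λ t → T (R A i t) × WalkTo ℓ (src t) × tgt t ≡ v

  walkTo? : ∀ ℓ v → Dec (WalkTo ℓ v)
  walkTo? zero    v = yes tt
  walkTo? (suc ℓ) v = ∃-Vec? (δ Δ i) λ t → T? (R A i t) ×-dec (walkTo? ℓ (src t) ×-dec (tgt t ≟ v))

module CutWitness (Δ : RelType) (i₀ : Fin (k Δ)) where

  open Positions Δ i₀

  data Forward : (i : Fin (k Δ)) → Vec (Fin 3) (δ Δ i) → Set where
    forward : ∀ {t} → src t < tgt t → Forward i₀ t

  forward? : ∀ i t → Dec (Forward i t)
  forward? i t with i ≟ i₀
  ... | no i≢i₀ = no λ { (forward _) → i≢i₀ refl }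
  ... | yes refl with src t <? tgt t
  ...   | yes lt = yes (forward lt)
  ...   | no ¬lt = no λ { (forward lt) → ¬lt lt }

  TT₃ : Str Δ
  TT₃ = record { m = 2 ; R = λ i t → ⌊ forward? i t ⌋ }

  TT₃-arc : ∀ {t} → T (R TT₃ i₀ t) → src t < tgt t
  TT₃-arc r with toWitness r
  ... | forward lt = lt

  -- Any entries would do beyond the first two positions.
  arc₃-entry : Fin 3 → Fin 3 → Fin (2 + extra) → Fin 3
  arc₃-entry a b zero          = a
  arc₃-entry a b (suc zero)    = b
  arc₃-entry a b (suc (suc _)) = a

  arc₃ : Fin 3 → Fin 3 → Vec (Fin 3) (δ Δ i₀)
  arc₃ a b = tuple (arc₃-entry a b)

  src-arc₃ : ∀ a b → src (arc₃ a b) ≡ a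
  src-arc₃ a b = lookup-tuple (arc₃-entry a b) zero

  tgt-arc₃ : ∀ a b → tgt (arc₃ a b) ≡ b
  tgt-arc₃ a b = lookup-tuple (arc₃-entry a b) (suc zero)

  arc₃∈TT₃ : ∀ {a b} → a < b → Forward i₀ (arc₃ a b)
  arc₃∈TT₃ {a} {b} a<b = forward (subst₂ _<_ (sym (src-arc₃ a b)) (sym (tgt-arc₃ a b)) a<b)

  module _ {B : Set} (g : Fin 3 → B) where

    image-arc : Fin 3 → Fin 3 → Vec B (δ Δ i₀)
    image-arc a b = map g (arc₃ a b)

    src-image-arc : ∀ a b → src (image-arc a b) ≡ g a
    src-image-arc a b = trans (src-map g (arc₃ a b)) (cong g (src-arc₃ a b))

    tgt-image-arc : ∀ a b → tgt (image-arc a b) ≡ g b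
    tgt-image-arc a b = trans (tgt-map g (arc₃ a b)) (cong g (tgt-arc₃ a b))

  rigid-TT₃ : Rigid TT₃
  rigid-TT₃ f f-hom = fixed
    where
    monotone : ∀ {a b} → a < b → f a < f b
    monotone {a} {b} a<b = subst₂ _<_ (src-image-arc f a b) (tgt-image-arc f a b)
      (TT₃-arc (f-hom i₀ (arc₃ a b) (fromWitness (arc₃∈TT₃ a<b))))
    fixed : ∀ x → f x ≡ x
    fixed = ∀-Fin3 (<-chain₃ (monotone 0<1) (monotone 1<2))

  TT₃-image⇒cycle : (B : Str Δ) → TT₃ ⟶ B → ICycle B
  TT₃-image⇒cycle B (g , g-hom) = transitive-triangle⇒cycle B i₀
    (image-arc g zero (suc zero)) (image-arc g (suc zero) (suc (suc zero))) (image-arc g zero (suc (suc zero)))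
    (g-hom i₀ _ (fromWitness (arc₃∈TT₃ 0<1)))
    (g-hom i₀ _ (fromWitness (arc₃∈TT₃ 1<2)))
    (g-hom i₀ _ (fromWitness (arc₃∈TT₃ 0<2)))
    (trans (tgt-image-arc g _ _) (sym (src-image-arc g _ _)))
    (trans (src-image-arc g _ _) (sym (src-image-arc g _ _)))
    (trans (tgt-image-arc g _ _) (sym (tgt-image-arc g _ _)))

  Loop : Str Δ
  Loop = record { m = 0 ; R = λ i _ → ⌊ i ≟ i₀ ⌋ }

  rigid-Loop : Rigid Loop
  rigid-Loop f _ zero with f zero
  ... | zero = refl

  only-i₀ : (W : Str Δ) → W ⟶ Loop → ∀ {i t} → T (R W i t) → i ≡ i₀
  only-i₀ W (_ , g-hom) {i} {t} r = toWitness (g-hom i t r)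

  -- TT₃⊎P₃ is the disjoint union of TT₃ and a directed path on four vertices; each arc of the
  -- path gets fresh vertices at its positions beyond the first two.
  Point : Set
  Point = Fin 3 ⊎ (Fin 4 ⊎ (Fin 3 × Fin extra))

  Point↔ : Fin (3 + (4 + 3 * extra)) ↔ Point
  Point↔ = (↔-id _ ⊎-↔ (↔-id _ ⊎-↔ *↔×)) ↔-∘ ((↔-id _ ⊎-↔ +↔⊎) ↔-∘ +↔⊎)

  opaque
    encode : Point → Fin (3 + (4 + 3 * extra))
    encode = Inverse.from Point↔

    decode : Fin (3 + (4 + 3 * extra)) → Point
    decode = Inverse.to Point↔

    decode-encode : ∀ c → decode (encode c) ≡ c
    decode-encode = Inverse.strictlyInverseˡ Point↔

    decode≡⇒≡encode : ∀ {v c} → decode v ≡ c → v ≡ encode c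
    decode≡⇒≡encode {v} e = trans (sym (Inverse.strictlyInverseʳ Point↔ v)) (cong encode e)

  tVertex : Fin 3 → Fin (3 + (4 + 3 * extra))
  tVertex x = encode (inj₁ x)

  tVertex-injective : Injective _≡_ _≡_ tVertex
  tVertex-injective {a} {b} e =
    inj₁-injective (trans (sym (decode-encode (inj₁ a))) (trans (cong decode e) (decode-encode (inj₁ b))))

  onPath : Fin 4 → Point
  onPath a = inj₂ (inj₁ a)

  pathPoint : Fin 3 → Fin (2 + extra) → Point
  pathPoint s zero          = onPath (inject₁ s)
  pathPoint s (suc zero)    = onPath (suc s)
  pathPoint s (suc (suc q)) = inj₂ (inj₂ (s , q))

  pathEntry : Fin 3 → Fin (2 + extra) → Fin (3 + (4 + 3 * extra))
  pathEntry s p = encode (pathPoint s p)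

  pathArc : Fin 3 → Vec (Fin (3 + (4 + 3 * extra))) (δ Δ i₀)
  pathArc s = tuple (pathEntry s)

  data UnionRel : (i : Fin (k Δ)) → Vec (Fin (3 + (4 + 3 * extra))) (δ Δ i) → Set where
    tournament : ∀ {i t} → Forward i t → UnionRel i (map tVertex t)
    path       : ∀ s → UnionRel i₀ (pathArc s)

  -- Opaque, so that conversion checking never runs this decision procedure.
  opaque
    UnionRel? : ∀ i t → Dec (UnionRel i t)
    UnionRel? i t with ∃-Vec? (δ Δ i) (λ t' → ≡-dec _≟_ t (map tVertex t') ×-dec forward? i t')
    ... | yes (t' , refl , fw) = yes (tournament fw)
    ... | no ¬tournament with i ≟ i₀
    ...   | no i≢i₀ = no λ { (tournament fw) → ¬tournament (_ , refl , fw) ; (path _) → i≢i₀ refl }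
    ...   | yes refl with any? (λ s → ≡-dec _≟_ t (pathArc s))
    ...     | yes (s , refl) = yes (path s)
    ...     | no ¬path = no λ { (tournament fw) → ¬tournament (_ , refl , fw) ; (path s) → ¬path (s , refl) }

  TT₃⊎P₃ : Str Δ
  TT₃⊎P₃ = record { m = 2 + (4 + 3 * extra) ; R = λ i t → ⌊ UnionRel? i t ⌋ }

  -- The arcs of TT₃⊎P₃, read on Point. The path constructor carries equations because
  -- inject₁ s is not a constructor pattern, so that Step-walk₃ can match consecutive steps.
  data Step : Point → Point → Set where
    tournament : ∀ {a b} → a < b → Step (inj₁ a) (inj₁ b)
    path       : ∀ {a b} s → a ≡ inject₁ s → b ≡ suc s → Step (inj₂ (inj₁ a)) (inj₂ (inj₁ b))

  Step-irrefl : ∀ {u} → Step u u → ⊥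
  Step-irrefl (tournament a<a)  = <-irrefl refl a<a
  Step-irrefl (path s refl s≡s) = <-irrefl refl (suc≡inject₁⇒< (sym s≡s))

  Step-walk₃ : ∀ {u v w x} → Step u v → Step v w → Step w x →
               u ≡ onPath zero × v ≡ onPath (suc zero) × w ≡ onPath (suc (suc zero))
  Step-walk₃ (tournament a<b) (tournament b<c) (tournament c<e) = ⊥-elim (¬<-chain₄ a<b b<c c<e)
  Step-walk₃ (path s refl refl) (path s' ss' refl) (path _ s's'' refl)
    with <-chain₃ (suc≡inject₁⇒< ss') (suc≡inject₁⇒< s's'')
  ... | refl , refl , _ = refl , refl , refl

  Step-triangle : ∀ {u v w} → Step u v → Step v w → Step u w →
                  u ≡ inj₁ zero × v ≡ inj₁ (suc zero) × w ≡ inj₁ (suc (suc zero))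
  Step-triangle (tournament a<b) (tournament b<c) (tournament _) with <-chain₃ a<b b<c
  ... | refl , refl , refl = refl , refl , refl
  Step-triangle (path s refl refl) (path s' ss' refl) (path s'' ss'' s's'')
    with inject₁-injective ss'' | suc-injective s's''
  ... | refl | refl = ⊥-elim (<-irrefl refl (suc≡inject₁⇒< ss'))

  decode-src-tournament : ∀ t → decode (src (map tVertex t)) ≡ inj₁ (src t)
  decode-src-tournament t = trans (cong decode (src-map tVertex t)) (decode-encode _)

  decode-tgt-tournament : ∀ t → decode (tgt (map tVertex t)) ≡ inj₁ (tgt t)
  decode-tgt-tournament t = trans (cong decode (tgt-map tVertex t)) (decode-encode _)

  decode-src-pathArc : ∀ s → decode (src (pathArc s)) ≡ onPath (inject₁ s)
  decode-src-pathArc s = trans (cong decode (lookup-tuple (pathEntry s) zero)) (decode-encode _)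

  decode-tgt-pathArc : ∀ s → decode (tgt (pathArc s)) ≡ onPath (suc s)
  decode-tgt-pathArc s = trans (cong decode (lookup-tuple (pathEntry s) (suc zero))) (decode-encode _)

  step : ∀ {t} → UnionRel i₀ t → Step (decode (src t)) (decode (tgt t))
  step (tournament {t = t} (forward lt)) =
    subst₂ Step (sym (decode-src-tournament t)) (sym (decode-tgt-tournament t)) (tournament lt)
  step (path s) = subst₂ Step (sym (decode-src-pathArc s)) (sym (decode-tgt-pathArc s)) (path s refl refl)

  pathArc-unique : ∀ {t s} → UnionRel i₀ t → decode (src t) ≡ onPath (inject₁ s) → t ≡ pathArc s
  pathArc-unique (tournament {t = t} _) e with trans (sym (decode-src-tournament t)) e
  ... | ()
  pathArc-unique (path s) e =
    cong pathArc (inject₁-injective (inj₁-injective (inj₂-injective (trans (sym (decode-src-pathArc s)) e))))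

  TT₃⟶TT₃⊎P₃ : TT₃ ⟶ TT₃⊎P₃
  TT₃⟶TT₃⊎P₃ = tVertex , λ i t r → fromWitness (tournament (toWitness r))

  TT₃⊎P₃⟶Loop : TT₃⊎P₃ ⟶ Loop
  TT₃⊎P₃⟶Loop = (λ _ → zero) , λ i t r → fromWitness (relation-i₀ (toWitness r))
    where
    relation-i₀ : ∀ {i t} → UnionRel i t → i ≡ i₀
    relation-i₀ (tournament (forward _)) = refl
    relation-i₀ (path _)                 = refl

  image-step : (W : Str Δ) (g : Base W → Base TT₃⊎P₃) → IsHom W TT₃⊎P₃ g →
               ∀ {t} → T (R W i₀ t) → Step (decode (g (src t))) (decode (g (tgt t)))
  image-step W g g-hom {t} r =
    subst₂ (λ u v → Step (decode u) (decode v)) (src-map g t) (tgt-map g t) (step (toWitness (g-hom i₀ t r)))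

  ¬Loop⟶TT₃⊎P₃ : ¬ (Loop ⟶ TT₃⊎P₃)
  ¬Loop⟶TT₃⊎P₃ (g , g-hom) = Step-irrefl (subst (λ x → Step (decode (g x)) (decode (g (tgt loop))))
    (single-point (src loop) (tgt loop)) (image-step Loop g g-hom {loop} (fromWitness refl)))
    where
    loop : Vec (Fin 1) (δ Δ i₀)
    loop = replicate _ zero
    single-point : (x y : Fin 1) → x ≡ y
    single-point zero zero = refl

  pathArc∈ : ∀ s → T (R TT₃⊎P₃ i₀ (pathArc s))
  pathArc∈ s = fromWitness (path s)

  ¬TT₃⊎P₃⟶TT₃ : ¬ (TT₃⊎P₃ ⟶ TT₃)
  ¬TT₃⊎P₃⟶TT₃ (g , g-hom) = ¬<-chain₄ (increases zero) (increases (suc zero)) (increases (suc (suc zero)))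
    where
    increases : ∀ s → g (pathEntry s zero) < g (pathEntry s (suc zero))
    increases s = subst₂ _<_ (trans (src-map g (pathArc s)) (cong g (lookup-tuple (pathEntry s) zero)))
                              (trans (tgt-map g (pathArc s)) (cong g (lookup-tuple (pathEntry s) (suc zero))))
                              (TT₃-arc (g-hom i₀ (pathArc s) (pathArc∈ s)))

  -- An endomorphism maps the path to a walk of three arcs and TT₃ to a transitive triangle;
  -- in TT₃⊎P₃ these are unique, so every vertex is fixed.
  rigid-TT₃⊎P₃ : Rigid TT₃⊎P₃
  rigid-TT₃⊎P₃ f f-hom v = begin
    f v                  ≡⟨ cong f (decode≡⇒≡encode refl) ⟩
    f (encode (decode v)) ≡⟨ fixed (decode v) ⟩
    encode (decode v)    ≡⟨ decode≡⇒≡encode refl ⟨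
    v                    ∎
    where
    open ≡-Reasoning

    path-step : ∀ s → Step (decode (f (pathEntry s zero))) (decode (f (pathEntry s (suc zero))))
    path-step s = subst₂ (λ u v → Step (decode (f u)) (decode (f v)))
      (lookup-tuple (pathEntry s) zero) (lookup-tuple (pathEntry s) (suc zero))
      (image-step TT₃⊎P₃ f f-hom (pathArc∈ s))

    decode-f-src : ∀ s → decode (f (pathEntry s zero)) ≡ onPath (inject₁ s)
    decode-f-src = ∀-Fin3 (Step-walk₃ (path-step zero) (path-step (suc zero)) (path-step (suc (suc zero))))

    pathArc-fixed : ∀ s → map f (pathArc s) ≡ pathArc s
    pathArc-fixed s = pathArc-unique (toWitness (f-hom i₀ (pathArc s) (pathArc∈ s)))
      (trans (cong decode (trans (src-map f (pathArc s)) (cong f (lookup-tuple (pathEntry s) zero))))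
             (decode-f-src s))

    pathEntry-fixed : ∀ s p → f (pathEntry s p) ≡ pathEntry s p
    pathEntry-fixed s p = begin
      f (pathEntry s p)                       ≡⟨ cong f (lookup-tuple (pathEntry s) p) ⟨
      f (lookup (pathArc s) (position p))     ≡⟨ lookup-map (position p) f (pathArc s) ⟨
      lookup (map f (pathArc s)) (position p) ≡⟨ cong (λ t → lookup t (position p)) (pathArc-fixed s) ⟩
      lookup (pathArc s) (position p)         ≡⟨ lookup-tuple (pathEntry s) p ⟩
      pathEntry s p                           ∎

    tournament-step : ∀ {a b} → a < b → Step (decode (f (tVertex a))) (decode (f (tVertex b)))
    tournament-step {a} {b} a<b = subst₂ (λ u v → Step (decode u) (decode v))
      (src-image-arc (λ x → f (tVertex x)) a b) (tgt-image-arc (λ x → f (tVertex x)) a b)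
      (step (toWitness (subst (λ t → T (R TT₃⊎P₃ i₀ t)) (sym (map-∘ f tVertex (arc₃ a b)))
        (f-hom i₀ (map tVertex (arc₃ a b)) (fromWitness (tournament (arc₃∈TT₃ a<b)))))))

    decode-f-tVertex : ∀ x → decode (f (tVertex x)) ≡ inj₁ x
    decode-f-tVertex = ∀-Fin3 (Step-triangle (tournament-step 0<1) (tournament-step 1<2) (tournament-step 0<2))

    fixed : ∀ c → f (encode c) ≡ encode c
    fixed (inj₁ x)                           = decode≡⇒≡encode (decode-f-tVertex x)
    fixed (inj₂ (inj₁ zero))                 = pathEntry-fixed zero zero
    fixed (inj₂ (inj₁ (suc zero)))           = pathEntry-fixed (suc zero) zero
    fixed (inj₂ (inj₁ (suc (suc zero))))     = pathEntry-fixed (suc (suc zero)) zero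
    fixed (inj₂ (inj₁ (suc (suc (suc zero))))) = pathEntry-fixed (suc (suc zero)) (suc zero)
    fixed (inj₂ (inj₂ (s , q)))              = pathEntry-fixed s (suc (suc q))

  module _ (W : Str Δ) where

    -- Without walks of three arcs, the number of arcs of a longest walk ending at v (at most 2)
    -- strictly increases along every arc.
    height : Base W → Fin 3
    height v = rank (walkTo? W i₀ 2 v) (walkTo? W i₀ 1 v)

    height-increases : (∀ v → ¬ WalkTo W i₀ 3 v) → ∀ {t} → T (R W i₀ t) → height (src t) < height (tgt t)
    height-increases no-walk₃ {t} t∈R =
      rank-< (walkTo? W i₀ 2 (src t)) (walkTo? W i₀ 1 (src t)) (walkTo? W i₀ 2 (tgt t)) (walkTo? W i₀ 1 (tgt t))
        (λ w₂ → no-walk₃ (tgt t) (t , t∈R , w₂ , refl)) (λ w₁ → t , t∈R , w₁ , refl) (t , t∈R , tt , refl)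

    height-hom : W ⟶ Loop → (∀ v → ¬ WalkTo W i₀ 3 v) → W ⟶ TT₃
    height-hom W⟶Loop no-walk₃ = height , hom
      where
      hom : IsHom W TT₃ height
      hom i t t∈R with only-i₀ W W⟶Loop t∈R
      ... | refl = fromWitness (forward (subst₂ _<_ (sym (src-map height t)) (sym (tgt-map height t))
                                          (height-increases no-walk₃ t∈R)))

    walk₃-hom : TT₃ ⟶ W → ∀ {v} → WalkTo W i₀ 3 v → TT₃⊎P₃ ⟶ W
    walk₃-hom (h , h-hom) (t₃ , t₃∈R , (t₂ , t₂∈R , (t₁ , t₁∈R , tt , t₁t₂) , t₂t₃) , _) = g , g-hom
      where
      arcAt : Fin 3 → Vec (Base W) (δ Δ i₀)
      arcAt zero             = t₁
      arcAt (suc zero)       = t₂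
      arcAt (suc (suc zero)) = t₃

      arcAt∈R : ∀ s → T (R W i₀ (arcAt s))
      arcAt∈R zero             = t₁∈R
      arcAt∈R (suc zero)       = t₂∈R
      arcAt∈R (suc (suc zero)) = t₃∈R

      pathVertex : Fin 4 → Base W
      pathVertex zero                   = src t₁
      pathVertex (suc zero)             = src t₂
      pathVertex (suc (suc zero))       = src t₃
      pathVertex (suc (suc (suc zero))) = tgt t₃

      onPoint : Point → Base W
      onPoint (inj₁ x)             = h x
      onPoint (inj₂ (inj₁ a))      = pathVertex a
      onPoint (inj₂ (inj₂ (s , q))) = lookup (arcAt s) (position (suc (suc q)))

      g : Base TT₃⊎P₃ → Base W
      g v = onPoint (decode v)

      onPoint-pathPoint : ∀ s p → onPoint (pathPoint s p) ≡ lookup (arcAt s) (position p)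
      onPoint-pathPoint zero             zero       = refl
      onPoint-pathPoint (suc zero)       zero       = refl
      onPoint-pathPoint (suc (suc zero)) zero       = refl
      onPoint-pathPoint zero             (suc zero) = sym t₁t₂
      onPoint-pathPoint (suc zero)       (suc zero) = sym t₂t₃
      onPoint-pathPoint (suc (suc zero)) (suc zero) = refl
      onPoint-pathPoint s          (suc (suc q))    = refl

      g-pathArc : ∀ s → map g (pathArc s) ≡ arcAt s
      g-pathArc s = tuple-ext λ p → begin
        lookup (map g (pathArc s)) (position p) ≡⟨ lookup-map (position p) g (pathArc s) ⟩
        g (lookup (pathArc s) (position p))     ≡⟨ cong g (lookup-tuple (pathEntry s) p) ⟩
        onPoint (decode (pathEntry s p))        ≡⟨ cong onPoint (decode-encode (pathPoint s p)) ⟩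
        onPoint (pathPoint s p)                 ≡⟨ onPoint-pathPoint s p ⟩
        lookup (arcAt s) (position p)           ∎
        where open ≡-Reasoning

      g-tournament : ∀ {n} (t : Vec (Fin 3) n) → map g (map tVertex t) ≡ map h t
      g-tournament t = trans (sym (map-∘ g tVertex t)) (map-cong (λ x → cong onPoint (decode-encode (inj₁ x))) t)

      g-hom : IsHom TT₃⊎P₃ W g
      g-hom i t t∈R with toWitness t∈R
      ... | tournament {t = t'} fw = subst (λ u → T (R W i u)) (sym (g-tournament t')) (h-hom i t' (fromWitness fw))
      ... | path s = subst (λ u → T (R W i₀ u)) (sym (g-pathArc s)) (arcAt∈R s)

    between-TT₃-and-Loop : TT₃ ⟶ W → W ⟶ Loop → (W ⟶ TT₃) ⊎ (TT₃⊎P₃ ⟶ W)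
    between-TT₃-and-Loop TT₃⟶W W⟶Loop with any? (walkTo? W i₀ 3)
    ... | yes (_ , walk₃) = inj₂ (walk₃-hom TT₃⟶W walk₃)
    ... | no ¬walk₃       = inj₁ (height-hom W⟶Loop (λ v walk₃ → ¬walk₃ (v , walk₃)))

  interval-split : ∀ W → Interval TT₃ Loop W → Interval TT₃ TT₃⊎P₃ W ⊎ Interval TT₃⊎P₃ Loop W
  interval-split W (TT₃⟶W , W⟶Loop) with between-TT₃-and-Loop W TT₃⟶W W⟶Loop
  ... | inj₁ W⟶TT₃ = inj₁ (TT₃⟶W , _∘ʰ_ {A = W} {B = TT₃} {C = TT₃⊎P₃} TT₃⟶TT₃⊎P₃ W⟶TT₃)
  ... | inj₂ TT₃⊎P₃⟶W = inj₂ (TT₃⊎P₃⟶W , W⟶Loop)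

  ¬CutFree : (𝒜 : Str Δ → Set) → 𝒜 TT₃⊎P₃ → ¬ CutFree 𝒜
  ¬CutFree 𝒜 𝒜∋TT₃⊎P₃ cutFree = cutFree (TT₃ , TT₃⊎P₃ , Loop , isCut)
    where
    isCut : IsCut 𝒜 TT₃ TT₃⊎P₃ Loop
    isCut = 𝒜∋TT₃⊎P₃ , rigid⇒core TT₃ rigid-TT₃ , rigid⇒core Loop rigid-Loop
          , (TT₃⟶TT₃⊎P₃ , ¬TT₃⊎P₃⟶TT₃) , (TT₃⊎P₃⟶Loop , ¬Loop⟶TT₃⊎P₃)
          , λ W _ → (λ (𝒜W , I) → 𝒜W , interval-split W I)
                  , (λ (𝒜W , I) → 𝒜W , Interval-trans {W = W} TT₃⟶TT₃⊎P₃ TT₃⊎P₃⟶Loop I)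

  core-TT₃⊎P₃ : IsCore TT₃⊎P₃
  core-TT₃⊎P₃ = rigid⇒core TT₃⊎P₃ rigid-TT₃⊎P₃

  TT₃⊎P₃∈C₁ : C₁ TT₃⊎P₃
  TT₃⊎P₃∈C₁ = core-TT₃⊎P₃ , λ (T' , (_ , acyclic) , TT₃⊎P₃⟶T') →
    acyclic (TT₃-image⇒cycle T' (_∘ʰ_ {A = TT₃} {B = TT₃⊎P₃} {C = T'} TT₃⊎P₃⟶T' TT₃⟶TT₃⊎P₃))

  TT₃⊎P₃∈C₃ : C₃ TT₃⊎P₃
  TT₃⊎P₃∈C₃ = core-TT₃⊎P₃ , TT₃-image⇒cycle TT₃⊎P₃ TT₃⟶TT₃⊎P₃

module DigraphCut where

  open CutWitness DigraphType zero public

  arc∈ : ∀ {a b} → a < b → T (arc TT₃⊎P₃ (tVertex a) (tVertex b))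
  arc∈ a<b = fromWitness (tournament (arc₃∈TT₃ a<b))

  TT₃⊎P₃∈D₅ : D₅ TT₃⊎P₃
  TT₃⊎P₃∈D₅ = core-TT₃⊎P₃ , record
    { r = 1 ; v = tVertex ; v-inj = tVertex-injective
    ; step = λ { zero → inj₁ (arc∈ 0<1) ; (suc zero) → inj₁ (arc∈ 1<2) } ; last = inj₂ (arc∈ 0<2) }

mainTheorem3 : ((Δ : RelType) → 1 ≤ k Δ → ¬ CutFree {Δ} C₁)
             × ((Δ : RelType) → 1 ≤ k Δ → ¬ CutFree {Δ} C₃)
             × ¬ CutFree {DigraphType} D₅
mainTheorem3 =
    (λ Δ 1≤k → CutWitness.¬CutFree Δ (fromℕ< 1≤k) C₁ (CutWitness.TT₃⊎P₃∈C₁ Δ (fromℕ< 1≤k)))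
  , (λ Δ 1≤k → CutWitness.¬CutFree Δ (fromℕ< 1≤k) C₃ (CutWitness.TT₃⊎P₃∈C₃ Δ (fromℕ< 1≤k)))
  , DigraphCut.¬CutFree D₅ DigraphCut.TT₃⊎P₃∈D₅
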